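{- Let $(V,w)$ be a finite metric space and $T=\{(s_1,t_1),\dots,(s_k,t_k)\}$ a set of pairwise disjoint terminal pairs with $2\le w(s_j,t_j)\le 2k^2$ for all $j$ and minimum terminal-pair distance equal to $2$. For each $0\le i\le L$ let $U_i$ be a maximal independent set in the ball graph $H_i$, $M_i=|U_i|$, with clusters $\mathcal{C}_i$ defined as below, and let $F\subseteq V\times V$ be an edge set such that any two vertices in a common cluster of $\mathcal{C}_0\cup\cdots\cup\mathcal{C}_L$ are connected in $(V,F)$. Then for every $i=0,\dots,L$ there exists a set of edges $J_i\subseteq V\times V$ of total cost at most $2M_i\cdot\tau_i$ such that every terminal $s\in\mathrm{Target}_i$ is connected to its match $m(s)$ in the graph $(V,F\cup J_i)$.
   Context: For a terminal $s$ its match $m(s)$ is the other vertex of its pair. $\tau_i=2^i$ and $L=\log_2(2k^2)$ (rounded to an integer). A terminal $s$ is active at level $i$ if $w(s,m(s))\ge\tau_i$; $V_i^H$ denotes the set of terminals active at level $i$ (defined for all $i\ge0$). The ball graph $H_i$ has vertex set $V_i^H$, with $u,v$ adjacent iff $w(u,v)<2\tau_i$. For $v\in V_i^H$, its center $c_i(v)$ is a point of $U_i$ closest to $v$ (ties broken arbitrarily); for $u\in U_i$, $C_i(u)=\{v\in V_i^H:c_i(v)=u\}$ and $\mathcal{C}_i=\{C_i(u):u\in U_i\}$. $\mathrm{Target}_i=V_i^H\setminus V_{i+1}^H$. In the paper, $F$ is the edge set produced by the preceding lemma (of cost at most $4\sum_i M_i\tau_i$), which has the stated cluster-connectivity property.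
   Formalization: The metric distances of $(V,w)$ take values in the rationals. -}

module Defs where

open import Data.Nat as ℕ using (ℕ; suc; _^_)
open import Data.Nat.Logarithm using (⌈log₂_⌉)
open import Data.Integer using (+_)
open import Data.Rational using (ℚ; _/_; _≤_; _<_; _+_; _*_; 0ℚ)
open import Data.Fin using (Fin)
open import Data.Fin.Subset using (Subset; _∈_; _⊆_)
open import Data.Bool using (Bool; true; false; not)
open import Data.Product using (_×_; _,_; ∃; ∃-syntax)
open import Data.Sum using (_⊎_)
open import Data.List using (List; foldr; _++_)
import Data.List.Membership.Propositional as LM
open import Relation.Binary.PropositionalEquality using (_≡_; _≢_)
open import Relation.Binary.Construct.Closure.Equivalence using (EqClosure)
open import Relation.Nullary using (¬_)

⟦_⟧ : ℕ → ℚ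
⟦ n ⟧ = + n / 1

record IsMetric {n : ℕ} (w : Fin n → Fin n → ℚ) : Set where
  field
    nonneg   : ∀ x y → 0ℚ ≤ w x y
    zero-iff : ∀ x y → (w x y ≡ 0ℚ → x ≡ y) × (x ≡ y → w x y ≡ 0ℚ)
    sym      : ∀ x y → w x y ≡ w y x
    triangle : ∀ x y z → w x z ≤ w x y + w y z

-- terminals are indexed by (j , b): (j , false) is s_j, (j , true) is t_j
Term : ℕ → Set
Term k = Fin k × Bool

pt : {n k : ℕ} → (Fin k → Fin n) → (Fin k → Fin n) → Term k → Fin n
pt s t (j , false) = s j
pt s t (j , true)  = t j

mate : {k : ℕ} → Term k → Term k
mate (j , b) = (j , not b)

τ : ℕ → ℚ
τ i = ⟦ 2 ^ i ⟧

Lvl : ℕ → ℕ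
Lvl k = ⌈log₂ (2 ℕ.* (k ℕ.* k)) ⌉

module Setup {n k : ℕ} (w : Fin n → Fin n → ℚ)
             (s t : Fin k → Fin n) where

  P : Term k → Fin n
  P = pt s t

  Active : ℕ → Fin n → Set
  Active i v = ∃[ x ] (P x ≡ v × τ i ≤ w (P x) (P (mate x)))

  Adj : ℕ → Fin n → Fin n → Set
  Adj i u v = Active i u × Active i v × u ≢ v × w u v < ⟦ 2 ⟧ * τ i

  IndepIn : ℕ → Subset n → Set
  IndepIn i S = (∀ v → v ∈ S → Active i v) × (∀ u v → u ∈ S → v ∈ S → ¬ Adj i u v)

  MaxIndep : ℕ → Subset n → Set
  MaxIndep i U = IndepIn i U × (∀ S → U ⊆ S → IndepIn i S → S ⊆ U)

  IsCenter : ℕ → Subset n → (Fin n → Fin n) → Set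
  IsCenter i U c = ∀ v → Active i v →
    (c v ∈ U) × (∀ u → u ∈ U → w v (c v) ≤ w v u)

  Target : ℕ → Fin n → Set
  Target i v = Active i v × ¬ Active (suc i) v

Connected : {n : ℕ} → List (Fin n × Fin n) → Fin n → Fin n → Set
Connected E = EqClosure (λ x y → (x , y) LM.∈ E)

cost : {n : ℕ} → (Fin n → Fin n → ℚ) → List (Fin n × Fin n) → ℚ
cost w = foldr (λ { (x , y) acc → w x y + acc }) 0ℚ

{-# OPTIONS --safe #-}
module Submission where

-- The pairs of Target_i are exactly the pairs at distance in [τ_i, 2τ_i). Scan them
-- greedily and keep a pair (s, t) only if the clusters of s and t are not yet joined
-- (by F plus the pairs kept so far); each kept pair merges two cluster classes, so at
-- most M_i pairs are kept, each of cost below 2τ_i.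

open import Defs
open import Data.Nat as ℕ using (ℕ; suc; _≤_; z≤n; s≤s; _^_)
import Data.Nat.Properties as ℕP
open import Data.Integer as ℤ using (+_)
import Data.Integer.Properties as ℤP
open import Data.Rational as ℚ using (ℚ; mkℚ; _/_)
import Data.Rational.Properties as ℚP
open import Data.Nat.Coprimality using (1-coprimeTo) renaming (sym to coprime-sym)
open import Data.Fin using (Fin; _≟_)
open import Data.Fin.Subset using (Subset; ∣_∣; _-_) renaming (_∈_ to _∈ₛ_)
open import Data.Fin.Subset.Properties using (x∈p⇒∣p-x∣<∣p∣; x∈p∧x≢y⇒x∈p-y)
open import Data.Bool using (true; false)
open import Data.Product using (_×_; _,_; ∃-syntax; proj₁)
open import Data.Sum using (_⊎_; inj₁; inj₂)
open import Data.List using (List; []; _∷_; [_]; _++_; length; map; filter; allFin)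
open import Data.List.Properties using (++-assoc)
open import Data.List.Membership.Propositional using (_∈_)
open import Data.List.Membership.Propositional.Properties
  using (∈-++⁺ˡ; ∈-++⁺ʳ; ∈-allFin; ∈-map∘filter⁺; ∈-map∘filter⁻)
open import Data.List.Relation.Binary.Subset.Propositional using (_⊆_)
open import Data.List.Relation.Unary.Any using (here; there)
open import Function using (_∘_)
open import Function.Definitions using (Injective)
open import Relation.Binary.Construct.Closure.Equivalence as EqClosure using ()
open import Relation.Binary.Construct.Closure.ReflexiveTransitive using (_◅◅_)
open import Relation.Binary.PropositionalEquality
  using (_≡_; _≢_; refl; sym; trans; cong; cong₂; subst; subst₂; module ≡-Reasoning)
open import Relation.Nullary using (yes; no)
open import Relation.Nullary.Decidable using (_×-dec_)
open import Relation.Unary using (Decidable)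

-- ⟦ a ⟧ in normal form: ℚ._+_ and ℚ._*_ compute on it, so the homomorphism laws become laws of ℤ.
⟦_⟧ᶜ : ℕ → ℚ
⟦ a ⟧ᶜ = mkℚ (+ a) 0 (coprime-sym (1-coprimeTo a))

⟦⟧≡⟦⟧ᶜ : ∀ a → ⟦ a ⟧ ≡ ⟦ a ⟧ᶜ
⟦⟧≡⟦⟧ᶜ a = ℚP.normalize-coprime (coprime-sym (1-coprimeTo a))

⟦⟧-homo-+ : ∀ a b → ⟦ a ℕ.+ b ⟧ ≡ ⟦ a ⟧ ℚ.+ ⟦ b ⟧
⟦⟧-homo-+ a b = begin
  + (a ℕ.+ b) / 1     ≡⟨ cong (_/ 1) (ℤP.pos-+ a b) ⟩
  (+ a ℤ.+ + b) / 1   ≡⟨ cong₂ (λ x y → (x ℤ.+ y) / 1) (ℤP.*-identityʳ (+ a)) (ℤP.*-identityʳ (+ b)) ⟨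
  ⟦ a ⟧ᶜ ℚ.+ ⟦ b ⟧ᶜ    ≡⟨ cong₂ ℚ._+_ (⟦⟧≡⟦⟧ᶜ a) (⟦⟧≡⟦⟧ᶜ b) ⟨
  ⟦ a ⟧ ℚ.+ ⟦ b ⟧      ∎
  where open ≡-Reasoning

⟦⟧-homo-* : ∀ a b → ⟦ a ℕ.* b ⟧ ≡ ⟦ a ⟧ ℚ.* ⟦ b ⟧
⟦⟧-homo-* a b = begin
  + (a ℕ.* b) / 1     ≡⟨ cong (_/ 1) (ℤP.pos-* a b) ⟩
  ⟦ a ⟧ᶜ ℚ.* ⟦ b ⟧ᶜ    ≡⟨ cong₂ ℚ._*_ (⟦⟧≡⟦⟧ᶜ a) (⟦⟧≡⟦⟧ᶜ b) ⟨
  ⟦ a ⟧ ℚ.* ⟦ b ⟧      ∎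
  where open ≡-Reasoning

⟦⟧-mono-≤ : ∀ {a b} → a ≤ b → ⟦ a ⟧ ℚ.≤ ⟦ b ⟧
⟦⟧-mono-≤ {a} {b} a≤b = subst₂ ℚ._≤_ (sym (⟦⟧≡⟦⟧ᶜ a)) (sym (⟦⟧≡⟦⟧ᶜ b))
  (ℚ.*≤* (subst₂ ℤ._≤_ (sym (ℤP.*-identityʳ (+ a))) (sym (ℤP.*-identityʳ (+ b))) (ℤ.+≤+ a≤b)))

cost-≤ : ∀ {n} (w : Fin n → Fin n → ℚ) d (J : List (Fin n × Fin n)) →
         (∀ {x y} → (x , y) ∈ J → w x y ℚ.≤ ⟦ d ⟧) → cost w J ℚ.≤ ⟦ length J ℕ.* d ⟧
cost-≤ w d []             _     = ℚP.≤-refl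
cost-≤ w d ((x , y) ∷ J) bound = begin
  w x y ℚ.+ cost w J              ≤⟨ ℚP.+-mono-≤ (bound (here refl)) (cost-≤ w d J (bound ∘ there)) ⟩
  ⟦ d ⟧ ℚ.+ ⟦ length J ℕ.* d ⟧    ≡⟨ ⟦⟧-homo-+ d (length J ℕ.* d) ⟨
  ⟦ d ℕ.+ length J ℕ.* d ⟧        ∎
  where open ℚP.≤-Reasoning

module _ {n : ℕ} where

  Connected-++⁺ˡ : ∀ {E : List (Fin n × Fin n)} E' {x y} → Connected E x y → Connected (E ++ E') x y
  Connected-++⁺ˡ E' = EqClosure.map ∈-++⁺ˡ

  Connected-sym : ∀ {E : List (Fin n × Fin n)} {x y} → Connected E x y → Connected E y x
  Connected-sym = EqClosure.symmetric _

  Connected-edge : ∀ {E : List (Fin n × Fin n)} {x y} → (x , y) ∈ E → Connected E x y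
  Connected-edge = EqClosure.return

merge : ∀ {m} → Fin m → Fin m → Fin m → Fin m
merge a b z with z ≟ a
... | yes _ = b
... | no  _ = z

module _ {m : ℕ} {a b : Fin m} where

  merge-∈ : ∀ {U : Subset m} {z} → a ≢ b → b ∈ₛ U → z ∈ₛ U → merge a b z ∈ₛ U - a
  merge-∈ {z = z} a≢b b∈U z∈U with z ≟ a
  ... | yes _   = x∈p∧x≢y⇒x∈p-y b∈U (a≢b ∘ sym)
  ... | no z≢a  = x∈p∧x≢y⇒x∈p-y z∈U z≢a

  merge-≡ : ∀ {z z'} → merge a b z ≡ merge a b z' →
            z ≡ z' ⊎ (z ≡ a × z' ≡ b) ⊎ (z ≡ b × z' ≡ a)
  merge-≡ {z} {z'} eq with z ≟ a | z' ≟ a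
  ... | yes z≡a | yes z'≡a = inj₁ (trans z≡a (sym z'≡a))
  ... | yes z≡a | no  _    = inj₂ (inj₁ (z≡a , sym eq))
  ... | no  _   | yes z'≡a = inj₂ (inj₂ (eq , z'≡a))
  ... | no  _   | no  _    = inj₁ eq

module _ {n : ℕ} (Q : Fin n → Set) where

  ConnectsClasses : ∀ {m} → List (Fin n × Fin n) → (Fin n → Fin m) → Set
  ConnectsClasses E ℓ = ∀ {u v} → Q u → Q v → ℓ u ≡ ℓ v → Connected E u v

  ConnectsClasses-++⁺ˡ : ∀ {m E} E' {ℓ : Fin n → Fin m} →
                         ConnectsClasses E ℓ → ConnectsClasses (E ++ E') ℓ
  ConnectsClasses-++⁺ˡ E' conn Qu Qv eq = Connected-++⁺ˡ E' (conn Qu Qv eq)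

  ConnectsClasses-merge : ∀ {m E x y} {ℓ : Fin n → Fin m} → (x , y) ∈ E → Q x → Q y →
                          ConnectsClasses E ℓ → ConnectsClasses E (merge (ℓ x) (ℓ y) ∘ ℓ)
  ConnectsClasses-merge xy Qx Qy conn Qu Qv eq with merge-≡ eq
  ... | inj₁ ℓu≡ℓv                  = conn Qu Qv ℓu≡ℓv
  ... | inj₂ (inj₁ (ℓu≡ℓx , ℓv≡ℓy)) =
    conn Qu Qx ℓu≡ℓx ◅◅ Connected-edge xy ◅◅ conn Qy Qv (sym ℓv≡ℓy)
  ... | inj₂ (inj₂ (ℓu≡ℓy , ℓv≡ℓx)) =
    conn Qu Qy ℓu≡ℓy ◅◅ Connected-sym (Connected-edge xy) ◅◅ conn Qx Qv (sym ℓv≡ℓx)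

  spanningForest : ∀ {m} (ℓ : Fin n → Fin m) (U : Subset m) (F P : List (Fin n × Fin n)) →
                   (∀ {v} → Q v → ℓ v ∈ₛ U) → ConnectsClasses F ℓ →
                   (∀ {x y} → (x , y) ∈ P → Q x × Q y) →
                   ∃[ J ] J ⊆ P × length J ≤ ∣ U ∣ ×
                          (∀ {x y} → (x , y) ∈ P → Connected (F ++ J) x y)
  spanningForest ℓ U F [] ℓ∈U conn QP = [] , (λ ()) , z≤n , λ ()
  spanningForest ℓ U F ((x , y) ∷ P) ℓ∈U conn QP with QP (here refl) | ℓ x ≟ ℓ y
  ... | Qx , Qy | yes ℓx≡ℓy =
    let J , J⊆P , |J|≤|U| , connP = spanningForest ℓ U F P ℓ∈U conn (QP ∘ there)
    in  J , there ∘ J⊆P , |J|≤|U| ,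
        λ { (here refl) → ConnectsClasses-++⁺ˡ J conn Qx Qy ℓx≡ℓy ; (there p) → connP p }
  ... | Qx , Qy | no ℓx≢ℓy =
    let J , J⊆P , |J|≤|U-ℓx| , connP =
          spanningForest (merge (ℓ x) (ℓ y) ∘ ℓ) (U - ℓ x) (F ++ [ x , y ]) P
            (λ Qv → merge-∈ ℓx≢ℓy (ℓ∈U Qy) (ℓ∈U Qv))
            (ConnectsClasses-merge (∈-++⁺ʳ F (here refl)) Qx Qy (ConnectsClasses-++⁺ˡ _ conn))
            (QP ∘ there)
    in  (x , y) ∷ J , (λ { (here refl) → here refl ; (there p) → there (J⊆P p) }) ,
        ℕP.≤-trans (s≤s |J|≤|U-ℓx|) (x∈p⇒∣p-x∣<∣p∣ (ℓ∈U Qx)) ,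
        λ { (here refl) → Connected-edge (∈-++⁺ʳ F (here refl))
          ; (there p)   → subst (λ E → Connected E _ _) (++-assoc F [ x , y ] J) (connP p) }

module Level {n k : ℕ} (w : Fin n → Fin n → ℚ) (s t : Fin k → Fin n) (i : ℕ) where

  open Setup w s t

  AtLevel : Fin k → Set
  AtLevel j = τ i ℚ.≤ w (s j) (t j) × w (s j) (t j) ℚ.< τ (suc i)

  atLevel? : Decidable AtLevel
  atLevel? j = (τ i ℚ.≤? w (s j) (t j)) ×-dec (w (s j) (t j) ℚ.<? τ (suc i))

  pair : Fin k → Fin n × Fin n
  pair j = s j , t j

  levelPairs : List (Fin n × Fin n)
  levelPairs = map pair (filter atLevel? (allFin k))

  ∈-levelPairs⁺ : ∀ {j} → AtLevel j → (s j , t j) ∈ levelPairs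
  ∈-levelPairs⁺ {j} atLevel = ∈-map∘filter⁺ pair atLevel? {xs = allFin k} (j , ∈-allFin j , refl , atLevel)

  ∈-levelPairs⁻ : ∀ {e} → e ∈ levelPairs → ∃[ j ] AtLevel j × e ≡ pair j
  ∈-levelPairs⁻ e∈ = let j , _ , e≡ , atLevel = ∈-map∘filter⁻ pair atLevel? {xs = allFin k} e∈
                    in j , atLevel , e≡

  levelPairs-short : ∀ {x y} → (x , y) ∈ levelPairs → w x y ℚ.≤ τ (suc i)
  levelPairs-short xy = short (∈-levelPairs⁻ xy)
    where
    short : ∀ {x y} → ∃[ j ] AtLevel j × (x , y) ≡ pair j → w x y ℚ.≤ τ (suc i)
    short (_ , (_ , w<τ) , refl) = ℚP.<⇒≤ w<τ

  levelPairs-cost : ∀ {N} (J : List (Fin n × Fin n)) → J ⊆ levelPairs → length J ≤ N →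
              cost w J ℚ.≤ ⟦ 2 ⟧ ℚ.* ⟦ N ⟧ ℚ.* τ i
  levelPairs-cost {N} J J⊆P |J|≤N = begin
    cost w J                      ≤⟨ cost-≤ w (2 ^ suc i) J (levelPairs-short ∘ J⊆P) ⟩
    ⟦ length J ℕ.* 2 ^ suc i ⟧     ≤⟨ ⟦⟧-mono-≤ (ℕP.*-monoˡ-≤ (2 ^ suc i) |J|≤N) ⟩
    ⟦ N ℕ.* (2 ℕ.* 2 ^ i) ⟧       ≡⟨ cong ⟦_⟧ (ℕP.*-assoc N 2 (2 ^ i)) ⟨
    ⟦ N ℕ.* 2 ℕ.* 2 ^ i ⟧         ≡⟨ cong (λ a → ⟦ a ℕ.* 2 ^ i ⟧) (ℕP.*-comm N 2) ⟩
    ⟦ 2 ℕ.* N ℕ.* 2 ^ i ⟧         ≡⟨ ⟦⟧-homo-* (2 ℕ.* N) (2 ^ i) ⟩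
    ⟦ 2 ℕ.* N ⟧ ℚ.* τ i            ≡⟨ cong (ℚ._* τ i) (⟦⟧-homo-* 2 N) ⟩
    ⟦ 2 ⟧ ℚ.* ⟦ N ⟧ ℚ.* τ i         ∎
    where open ℚP.≤-Reasoning

  module _ (w-sym : ∀ x y → w x y ≡ w y x) where

    levelPairs-active : ∀ {x y} → (x , y) ∈ levelPairs → Active i x × Active i y
    levelPairs-active xy = active (∈-levelPairs⁻ xy)
      where
      active : ∀ {x y} → ∃[ j ] AtLevel j × (x , y) ≡ pair j → Active i x × Active i y
      active (j , (long , _) , refl) =
        ((j , false) , refl , long) , ((j , true) , refl , subst (τ i ℚ.≤_) (w-sym (s j) (t j)) long)

    module _ (inj : Injective _≡_ _≡_ P) where

      target-bounds : ∀ x → Target i (P x) →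
                      τ i ℚ.≤ w (P x) (P (mate x)) × w (P x) (P (mate x)) ℚ.< τ (suc i)
      target-bounds x ((y , Py≡Px , long) , inactive) =
        subst (λ z → τ i ℚ.≤ w (P z) (P (mate z))) (inj {y} {x} Py≡Px) long ,
        ℚP.≰⇒> (λ long' → inactive (x , refl , long'))

      target-connected : ∀ {E} → (∀ {j} → AtLevel j → Connected E (s j) (t j)) →
                         ∀ x → Target i (P x) → Connected E (P x) (P (mate x))
      target-connected conn (j , false) target = conn (target-bounds (j , false) target)
      target-connected conn (j , true)  target = Connected-sym (conn (subst
        (λ d → τ i ℚ.≤ d × d ℚ.< τ (suc i)) (w-sym (t j) (s j)) (target-bounds (j , true) target)))

lemma2p4 : (n k : ℕ) (w : Fin n → Fin n → ℚ) → IsMetric w →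
  (s t : Fin k → Fin n) →
  Injective _≡_ _≡_ (pt s t) →
  (∀ j → (⟦ 2 ⟧ ℚ.≤ w (s j) (t j)) × (w (s j) (t j) ℚ.≤ ⟦ 2 ℕ.* (k ℕ.* k) ⟧)) →
  (∃[ j ] w (s j) (t j) ≡ ⟦ 2 ⟧) →
  (U : ℕ → Subset n) →
  (∀ i → i ≤ Lvl k → Setup.MaxIndep w s t i (U i)) →
  (c : ℕ → Fin n → Fin n) →
  (∀ i → i ≤ Lvl k → Setup.IsCenter w s t i (U i) (c i)) →
  (F : List (Fin n × Fin n)) →
  (∀ j → j ≤ Lvl k → ∀ v v' → Setup.Active w s t j v → Setup.Active w s t j v' →
     c j v ≡ c j v' → Connected F v v') →
  ∀ i → i ≤ Lvl k →
    ∃[ J ] ((cost w J ℚ.≤ ⟦ 2 ⟧ ℚ.* ⟦ ∣ U i ∣ ⟧ ℚ.* τ i) ×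
            (∀ x → Setup.Target w s t i (pt s t x) →
               Connected (F ++ J) (pt s t x) (pt s t (mate x))))
lemma2p4 n k w isMetric s t inj _ _ U _ c isCenter F connF i i≤L =
  let J , J⊆P , |J|≤|U| , connP =
        spanningForest (Active i) (c i) (U i) F levelPairs
          (λ {v} active → proj₁ (isCenter i i≤L v active)) (λ {u} {v} → connF i i≤L u v)
          (levelPairs-active w-sym)
  in  J , levelPairs-cost J J⊆P |J|≤|U| ,
      target-connected w-sym inj (connP ∘ ∈-levelPairs⁺)
  where
  open Setup w s t
  open Level w s t i
  w-sym : ∀ x y → w x y ≡ w y x
  w-sym = IsMetric.sym isMetric
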